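{- Let $D$ be a strongly connected digraph with $m\ge 3$ arcs. Then $rc^*(D)=src^*(D)=m$ if and only if $D$ is the directed cycle $\vec{C}_m$ of length $m$.
   Context: Digraphs are finite, without loops or multiple arcs. For an arc-colouring of a strongly connected digraph $D$, a directed path is rainbow if no two of its arcs have the same colour. $rc^*(D)$ is the minimum number of colours in an arc-colouring such that for every ordered pair of distinct vertices $x,y$ there is a rainbow directed $xy$-path. $src^*(D)$ is the minimum number of colours in an arc-colouring such that for every ordered pair of distinct vertices $x,y$ there is a rainbow directed $xy$-path of length equal to the directed distance $d_D(x,y)$. -}

module Defs where

open import Data.Nat using (ℕ; zero; suc; _≤_; _<_; _∸_)
open import Data.Fin using (Fin; toℕ)
open import Data.Bool using (Bool; true; false)
open import Data.List using (List; []; _∷_; map; length)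
open import Data.List.Relation.Unary.Unique.Propositional using (Unique)
open import Data.Product using (Σ; _×_; _,_; ∃; ∃-syntax)
open import Data.Sum using (_⊎_)
open import Relation.Binary.PropositionalEquality using (_≡_)
open import Relation.Nullary using (¬_)
open import Function.Bundles using (_↔_; _⇔_; Inverse)

-- A finite digraph without loops (and, being given by a Boolean
-- adjacency relation, without multiple arcs). Vertices are Fin n.
record Digraph : Set where
  field
    n        : ℕ
    adj      : Fin n → Fin n → Bool
    loopless : ∀ x → adj x x ≡ false

open Digraph public

V : Digraph → Set
V D = Fin (n D)

Arc : Digraph → Set
Arc D = Σ (V D × V D) λ { (x , y) → adj D x y ≡ true }

data Walk (D : Digraph) : V D → V D → Set where
  []  : ∀ {x} → Walk D x x
  _∷_ : ∀ {x y z} → adj D x y ≡ true → Walk D y z → Walk D x z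

vertices : ∀ {D x y} → Walk D x y → List (V D)
vertices {x = x} [] = x ∷ []
vertices {x = x} (_ ∷ w) = x ∷ vertices w

arcs : ∀ {D x y} → Walk D x y → List (Arc D)
arcs [] = []
arcs {x = x} (_∷_ {y = y} a w) = ((x , y) , a) ∷ arcs w

len : ∀ {D x y} → Walk D x y → ℕ
len w = length (arcs w)

IsPath : ∀ {D x y} → Walk D x y → Set
IsPath w = Unique (vertices w)

StronglyConnected : Digraph → Set
StronglyConnected D = ∀ (x y : V D) → ∃[ w ] (IsPath {D} {x} {y} w)

Colouring : Digraph → ℕ → Set
Colouring D k = Arc D → Fin k

Rainbow : ∀ {D k x y} → Colouring D k → Walk D x y → Set
Rainbow c w = Unique (map c (arcs w))

-- a path whose length equals the directed distance d_D(x,y),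
-- i.e. its length is at most that of every directed xy-path
IsGeodesic : ∀ {D x y} → Walk D x y → Set
IsGeodesic {D} {x} {y} w = IsPath w × (∀ (q : Walk D x y) → IsPath q → len w ≤ len q)

RainbowConnecting : ∀ {D k} → Colouring D k → Set
RainbowConnecting {D} c =
  ∀ (x y : V D) → ¬ (x ≡ y) → ∃[ w ] (IsPath {D} {x} {y} w × Rainbow c w)

StronglyRainbowConnecting : ∀ {D k} → Colouring D k → Set
StronglyRainbowConnecting {D} c =
  ∀ (x y : V D) → ¬ (x ≡ y) → ∃[ w ] (IsGeodesic {D} {x} {y} w × Rainbow c w)

rc*≡ : Digraph → ℕ → Set
rc*≡ D k = (∃[ c ] RainbowConnecting {D} {k} c)
         × (∀ j → j < k → ¬ (∃[ c ] RainbowConnecting {D} {j} c))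

src*≡ : Digraph → ℕ → Set
src*≡ D k = (∃[ c ] StronglyRainbowConnecting {D} {k} c)
          × (∀ j → j < k → ¬ (∃[ c ] StronglyRainbowConnecting {D} {j} c))

HasArcs : Digraph → ℕ → Set
HasArcs D m = Fin m ↔ Arc D

-- arc relation of the directed cycle C_m on vertex set Fin m:
-- i → i+1 (mod m)
CycleArc : (m : ℕ) → Fin m → Fin m → Set
CycleArc m i j = (toℕ j ≡ suc (toℕ i)) ⊎ ((toℕ i ≡ m ∸ 1) × (toℕ j ≡ 0))

IsDirectedCycle : Digraph → ℕ → Set
IsDirectedCycle D m =
  Σ (Fin m ↔ V D) λ f →
    ∀ (i j : Fin m) → (adj D (Inverse.to f i) (Inverse.to f j) ≡ true) ⇔ CycleArc m i j

-- A colouring in which equal colours force equal tails makes every path rainbow,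
-- since the tails along a path are distinct. So if some vertex has two out-arcs,
-- merging their two colours gives a rainbow connecting colouring with m − 1
-- colours; hence rc* = m forces every out-degree to be at most one, and a strongly
-- connected digraph with this property is the orbit of its successor map, i.e. a
-- directed cycle. Conversely, in a directed cycle the only path from the successor
-- of x back to x uses every arc not leaving x; with at least three vertices any two
-- arcs have tails avoiding some common x, so every rainbow connecting colouring is
-- injective, while an injective colouring is strongly rainbow connecting.
module Submission where

open import Defs
open import Data.Nat using (ℕ; zero; suc; pred; _≤_; _<_; _∸_; z≤n; s≤s)
open import Data.Nat.Properties using (n<1+n; n≮n; m≤n⇒m<n∨m≡n)
import Data.Nat.GeneralisedArithmetic as ℕ
open import Data.Fin using (Fin; zero; suc; toℕ; fromℕ<; punchIn; punchOut; _≟_)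
open import Data.Fin.Properties
  using (toℕ-injective; toℕ<n; toℕ-fromℕ<; <⇒≢; pigeonhole;
         punchInᵢ≢i; punchIn-injective; punchIn-punchOut; punchOut-injective)
open import Data.Fin.Permutation using (↔⇒≡; cast-id)
open import Data.Bool using (true)
open import Data.List as List using (List; []; _∷_; map; length)
open import Data.List.Properties using (length-iterate; lookup-iterate)
open import Data.List.Membership.Propositional using (_∈_)
open import Data.List.Membership.Propositional.Properties using (∈-lookup; ∈-AllPairs₂)
open import Data.List.Membership.Propositional.Properties.WithK using (unique⇒irrelevant)
open import Data.List.Relation.Unary.Any using (here; there; index)
open import Data.List.Relation.Unary.Any.Properties using (lookup-index)
import Data.List.Relation.Unary.All as All
open import Data.List.Relation.Unary.All.Properties using (anti-mono)
import Data.List.Relation.Unary.AllPairs as AllPairs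
import Data.List.Relation.Unary.AllPairs.Properties as AllPairsₚ
open import Data.List.Relation.Unary.AllPairs using ([]; _∷_)
open import Data.List.Relation.Unary.Unique.Propositional using (Unique)
open import Data.Product using (Σ; _×_; _,_; proj₁; proj₂; map₂; ∃; ∃-syntax)
open import Data.Sum using (_⊎_; inj₁; inj₂)
open import Data.Empty using (⊥-elim)
open import Function using (_∘_)
open import Function.Bundles using (_↔_; _⇔_; Equivalence; Inverse; Injection; mk↔ₛ′; mk⇔)
open import Function.Construct.Composition using (_↔-∘_; _⇔-∘_)
open import Function.Construct.Symmetry using (↔-sym; ⇔-sym)
open import Function.Properties.Inverse using (↔⇒↣)
open import Relation.Nullary using (¬_; yes; no; contradiction)
open import Relation.Binary.PropositionalEquality
open import Relation.Binary.PropositionalEquality.WithK using (≡-irrelevant)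

↔-to-injective : ∀ {A B : Set} (f : A ↔ B) {x y} → Inverse.to f x ≡ Inverse.to f y → x ≡ y
↔-to-injective f = Injection.injective (↔⇒↣ f)

↔-from-injective : ∀ {A B : Set} (f : A ↔ B) {x y} → Inverse.from f x ≡ Inverse.from f y → x ≡ y
↔-from-injective f = ↔-to-injective (↔-sym f)

unique-map-finer : ∀ {A B C : Set} {t : A → B} {c : A → C} →
                   (∀ {a b} → c a ≡ c b → t a ≡ t b) →
                   ∀ {l} → Unique (map t l) → Unique (map c l)
unique-map-finer c⇒t u =
  AllPairsₚ.map⁺ (AllPairs.map (λ t≢ c≡ → t≢ (c⇒t c≡)) (AllPairsₚ.map⁻ u))

unique-map-injective : ∀ {A C : Set} {c : A → C} {l a b} →
                       Unique (map c l) → a ∈ l → b ∈ l → c a ≡ c b → a ≡ b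
unique-map-injective u a∈ b∈ c≡ with ∈-AllPairs₂ (AllPairsₚ.map⁻ u) a∈ b∈
... | inj₁ a≡b        = a≡b
... | inj₂ (inj₁ c≢) = contradiction c≡ c≢
... | inj₂ (inj₂ c≢) = contradiction (sym c≡) c≢

index-∈-lookup : ∀ {A : Set} (xs : List A) (i : Fin (length xs)) →
                 index (∈-lookup {xs = xs} i) ≡ i
index-∈-lookup (x ∷ xs) zero    = refl
index-∈-lookup (x ∷ xs) (suc i) = cong suc (index-∈-lookup xs i)

enumeration : ∀ {A : Set} {xs : List A} → Unique xs → (∀ x → x ∈ xs) → Fin (length xs) ↔ A
enumeration {xs = xs} u complete = mk↔ₛ′ (List.lookup xs) (index ∘ complete)
  (λ x → sym (lookup-index (complete x)))
  (λ i → trans (cong index (unique⇒irrelevant u (complete (List.lookup xs i)) (∈-lookup i)))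
               (index-∈-lookup xs i))

module _ {n : ℕ} {i j : Fin (suc n)} (i≢j : i ≢ j) where

  private
    redirect : Fin (suc n) → Fin (suc n)
    redirect k with k ≟ j
    ... | yes _ = i
    ... | no _  = k

    j≢redirect : ∀ k → j ≢ redirect k
    j≢redirect k with k ≟ j
    ... | yes _   = i≢j ∘ sym
    ... | no k≢j = k≢j ∘ sym

    redirect-≡ : ∀ {k l} → redirect k ≡ redirect l →
                 k ≡ l ⊎ ((k ≡ i ⊎ k ≡ j) × (l ≡ i ⊎ l ≡ j))
    redirect-≡ {k} {l} eq with k ≟ j | l ≟ j
    ... | yes k≡j | yes l≡j = inj₁ (trans k≡j (sym l≡j))
    ... | yes k≡j | no _    = inj₂ (inj₂ k≡j , inj₁ (sym eq))
    ... | no _    | yes l≡j = inj₂ (inj₁ eq , inj₂ l≡j)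
    ... | no _    | no _    = inj₁ eq

  identify : Fin (suc n) → Fin n
  identify k = punchOut (j≢redirect k)

  identify-≡ : ∀ {k l} → identify k ≡ identify l →
               k ≡ l ⊎ ((k ≡ i ⊎ k ≡ j) × (l ≡ i ⊎ l ≡ j))
  identify-≡ {k} {l} = redirect-≡ ∘ punchOut-injective (j≢redirect k) (j≢redirect l)

avoid-two : ∀ {n} → 3 ≤ n → (t₁ t₂ : Fin n) → ∃ λ x → x ≢ t₁ × x ≢ t₂
avoid-two (s≤s (s≤s (s≤s _))) t₁ t₂ with t₁ ≟ t₂
... | yes refl  = punchIn t₁ zero , punchInᵢ≢i t₁ zero , punchInᵢ≢i t₁ zero
... | no t₁≢t₂ = punchIn t₁ (punchIn u zero) , punchInᵢ≢i t₁ _ , ≢t₂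
  where
  u = punchOut t₁≢t₂
  ≢t₂ : punchIn t₁ (punchIn u zero) ≢ t₂
  ≢t₂ eq = punchInᵢ≢i u zero
    (punchIn-injective t₁ _ _ (trans eq (sym (punchIn-punchOut t₁≢t₂))))

iterate-suc : ∀ {A : Set} (f : A → A) x n → ℕ.iterate f x (suc n) ≡ f (ℕ.iterate f x n)
iterate-suc f x zero    = refl
iterate-suc f x (suc n) = iterate-suc f (f x) n

module _ {A : Set} (f : A → A) (u : A) {m : ℕ} where

  orbit↔ : Unique (List.iterate f u m) → (∀ x → x ∈ List.iterate f u m) → Fin m ↔ A
  orbit↔ uq complete = enumeration uq complete ↔-∘ cast-id (sym (length-iterate f u m))

  orbit↔-to : ∀ uq complete (i : Fin m) →
              Inverse.to (orbit↔ uq complete) i ≡ ℕ.iterate f u (toℕ i)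
  orbit↔-to _ _ = lookup-iterate f u m

cycleArc⇔next : ∀ {A : Set} (f : A → A) (u : A) {n : ℕ} →
                ℕ.iterate f u (suc n) ≡ u →
                (∀ {i j : Fin (suc n)} → ℕ.iterate f u (toℕ i) ≡ ℕ.iterate f u (toℕ j) → i ≡ j) →
                ∀ i j → CycleArc (suc n) i j ⇔ (ℕ.iterate f u (toℕ j) ≡ f (ℕ.iterate f u (toℕ i)))
cycleArc⇔next f u {n} period injective i j = mk⇔ toNext fromNext
  where
  orbit = ℕ.iterate f u
  step : orbit (suc (toℕ i)) ≡ f (orbit (toℕ i))
  step = iterate-suc f u (toℕ i)

  toNext : CycleArc (suc n) i j → orbit (toℕ j) ≡ f (orbit (toℕ i))
  toNext (inj₁ j≡i+1)       = trans (cong orbit j≡i+1) step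
  toNext (inj₂ (i≡n , j≡0)) = begin
    orbit (toℕ j)       ≡⟨ cong orbit j≡0 ⟩
    u                   ≡⟨ sym period ⟩
    orbit (suc n)       ≡⟨ cong (orbit ∘ suc) (sym i≡n) ⟩
    orbit (suc (toℕ i)) ≡⟨ step ⟩
    f (orbit (toℕ i))   ∎
    where open ≡-Reasoning

  fromNext : orbit (toℕ j) ≡ f (orbit (toℕ i)) → CycleArc (suc n) i j
  fromNext next with m≤n⇒m<n∨m≡n (toℕ<n i)
  ... | inj₁ i+1<m = inj₁ (trans (cong toℕ (injective orbit≡)) (toℕ-fromℕ< i+1<m))
    where
    orbit≡ : orbit (toℕ j) ≡ orbit (toℕ (fromℕ< i+1<m))
    orbit≡ = trans next (trans (sym step) (cong orbit (sym (toℕ-fromℕ< i+1<m))))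
  ... | inj₂ i+1≡m = inj₂ (cong pred i+1≡m , cong toℕ (injective {j} {zero} orbit≡))
    where
    orbit≡ : orbit (toℕ j) ≡ u
    orbit≡ = trans next (trans (sym step) (trans (cong orbit i+1≡m) period))

last-has-no-successor : ∀ {m} (i j : Fin m) → toℕ i ≡ m ∸ 1 → toℕ j ≢ suc (toℕ i)
last-has-no-successor {suc n} i j i≡n j≡i+1 =
  n≮n (suc n) (subst (_< suc n) (trans j≡i+1 (cong suc i≡n)) (toℕ<n j))

cycleArc-functional : ∀ {m} {i j j′ : Fin m} → CycleArc m i j → CycleArc m i j′ → j ≡ j′
cycleArc-functional (inj₁ e)       (inj₁ e′)       = toℕ-injective (trans e (sym e′))
cycleArc-functional (inj₂ (_ , e)) (inj₂ (_ , e′)) = toℕ-injective (trans e (sym e′))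
cycleArc-functional {i = i} {j} (inj₁ e) (inj₂ (last , _)) =
  ⊥-elim (last-has-no-successor i j last e)
cycleArc-functional {i = i} {j′ = j′} (inj₂ (last , _)) (inj₁ e′) =
  ⊥-elim (last-has-no-successor i j′ last e′)

Functional : Digraph → Set
Functional D = ∀ {x y y′} → adj D x y ≡ true → adj D x y′ ≡ true → y ≡ y′

module _ {D : Digraph} where

  tail head : Arc D → V D
  tail ((x , _) , _) = x
  head ((_ , y) , _) = y

  arc-≡ : ∀ {x y y′} (a : adj D x y ≡ true) (b : adj D x y′ ≡ true) → y ≡ y′ →
          _≡_ {A = Arc D} ((x , y) , a) ((x , y′) , b)
  arc-≡ a b refl = cong (_ ,_) (≡-irrelevant a b)

  adj⇒≢ : ∀ {x y} → adj D x y ≡ true → x ≢ y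
  adj⇒≢ {x} a refl = contradiction (trans (sym a) (loopless D x)) λ ()

  start∈vertices : ∀ {x y} (w : Walk D x y) → x ∈ vertices w
  start∈vertices []      = here refl
  start∈vertices (_ ∷ _) = here refl

  end∈vertices : ∀ {x y} (w : Walk D x y) → y ∈ vertices w
  end∈vertices []      = here refl
  end∈vertices (_ ∷ w) = there (end∈vertices w)

  arc-head∈vertices : ∀ {x y} (w : Walk D x y) {e} → e ∈ arcs w → head e ∈ vertices w
  arc-head∈vertices (_ ∷ w) (here refl) = there (start∈vertices w)
  arc-head∈vertices (_ ∷ w) (there e∈)  = there (arc-head∈vertices w e∈)

  arc-tail∈vertices : ∀ {x y} (w : Walk D x y) {z} → z ∈ map tail (arcs w) → z ∈ vertices w
  arc-tail∈vertices (_ ∷ w) (here refl) = here refl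
  arc-tail∈vertices (_ ∷ w) (there z∈)  = there (arc-tail∈vertices w z∈)

  ∈-vertices⇒arc : ∀ {x y z} (w : Walk D x y) → z ∈ vertices w → z ≢ y →
                   ∃ λ v → Σ (adj D z v ≡ true) λ a → ((z , v) , a) ∈ arcs w
  ∈-vertices⇒arc []      (here refl) z≢y = contradiction refl z≢y
  ∈-vertices⇒arc (a ∷ w) (here refl) _   = _ , a , here refl
  ∈-vertices⇒arc (_ ∷ w) (there z∈)  z≢y with ∈-vertices⇒arc w z∈ z≢y
  ... | v , a , a∈ = v , a , there a∈

  path-tails-unique : ∀ {x y} (w : Walk D x y) → IsPath w → Unique (map tail (arcs w))
  path-tails-unique []      _          = []
  path-tails-unique (_ ∷ w) (x∉ ∷ uq) =
    anti-mono (arc-tail∈vertices w) x∉ ∷ path-tails-unique w uq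

  tailDetermined⇒rainbow : ∀ {k} {c : Colouring D k} → (∀ {a b} → c a ≡ c b → tail a ≡ tail b) →
                           ∀ {x y} (w : Walk D x y) → IsPath w → Rainbow c w
  tailDetermined⇒rainbow c⇒t w path = unique-map-finer c⇒t (path-tails-unique w path)

  tailDetermined⇒rainbowConnecting : StronglyConnected D → ∀ {k} (c : Colouring D k) →
                                     (∀ {a b} → c a ≡ c b → tail a ≡ tail b) → RainbowConnecting c
  tailDetermined⇒rainbowConnecting sc c c⇒t x y _ =
    let w , path = sc x y in w , path , tailDetermined⇒rainbow c⇒t w path

  stronglyRainbowConnecting⇒rainbowConnecting : ∀ {k} {c : Colouring D k} →
    StronglyRainbowConnecting {D} c → RainbowConnecting {D} c
  stronglyRainbowConnecting⇒rainbowConnecting src x y x≢y =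
    let w , (path , _) , rainbow = src x y x≢y in w , path , rainbow

  outArc : StronglyConnected D → Arc D → ∀ x → ∃ λ y → adj D x y ≡ true
  outArc sc ((a , b) , ab) x with x ≟ a
  ... | yes refl = b , ab
  ... | no x≢a  = firstArc (proj₁ (sc x a)) x≢a
    where
    firstArc : ∀ {z} → Walk D x z → x ≢ z → ∃ λ y → adj D x y ≡ true
    firstArc []      x≢x = contradiction refl x≢x
    firstArc (a ∷ _) _   = _ , a

  module _ (functional : Functional D) where

    tail-injective : (a b : Arc D) → tail a ≡ tail b → a ≡ b
    tail-injective ((x , _) , a) ((.x , _) , b) refl = arc-≡ a b (functional a b)

    path-shortest : ∀ {x y} (p q : Walk D x y) → IsPath p → len p ≤ len q
    path-shortest []      _       _            = z≤n
    path-shortest (_ ∷ p) []      (x∉ ∷ _)    = contradiction refl (All.lookup x∉ (end∈vertices p))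
    path-shortest (a ∷ p) (b ∷ q) (_ ∷ path) with functional a b
    ... | refl = s≤s (path-shortest p q path)

    injective⇒stronglyRainbowConnecting : StronglyConnected D → ∀ {k} (c : Colouring D k) →
                                          (∀ {a b} → c a ≡ c b → a ≡ b) → StronglyRainbowConnecting c
    injective⇒stronglyRainbowConnecting sc c injective x y _ =
      let w , path = sc x y in
      w , (path , λ q _ → path-shortest w q path)
        , tailDetermined⇒rainbow (cong tail ∘ injective) w path

  module FunctionalDigraph (sc : StronglyConnected D) (functional : Functional D) (e₀ : Arc D) where

    next : V D → V D
    next x = proj₁ (outArc sc e₀ x)

    next-adj : ∀ x → adj D x (next x) ≡ true
    next-adj x = proj₂ (outArc sc e₀ x)

    adj⇒next : ∀ {x y} → adj D x y ≡ true → y ≡ next x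
    adj⇒next {x} a = functional a (next-adj x)

    adj⇔next : ∀ {x y} → adj D x y ≡ true ⇔ y ≡ next x
    adj⇔next {x} = mk⇔ adj⇒next λ { refl → next-adj x }

    tail↔ : Arc D ↔ V D
    tail↔ = mk↔ₛ′ tail (λ x → (x , next x) , next-adj x) (λ _ → refl)
                  (λ e → tail-injective functional _ e refl)

    walk-vertices : ∀ {u v} (w : Walk D u v) → vertices w ≡ List.iterate next u (suc (len w))
    walk-vertices []          = refl
    walk-vertices {u} (a ∷ w) with adj⇒next a
    ... | refl = cong (u ∷_) (walk-vertices w)

    walk-end : ∀ {u v} (w : Walk D u v) → ℕ.iterate next u (len w) ≡ v
    walk-end []      = refl
    walk-end (a ∷ w) with adj⇒next a
    ... | refl = walk-end w

    reachable-closed : ∀ {P : V D → Set} → (∀ {z} → P z → P (next z)) →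
                       ∀ {u v} → Walk D u v → P u → P v
    reachable-closed closed []      pu = pu
    reachable-closed closed (a ∷ w) pu =
      reachable-closed closed w (subst _ (sym (adj⇒next a)) (closed pu))

    cycle-next-closed : ∀ {x y} → adj D x y ≡ true → (p : Walk D y x) →
                        ∀ {z} → z ∈ vertices p → next z ∈ vertices p
    cycle-next-closed {x} x→y p {z} z∈ with z ≟ x
    ... | yes refl = subst (_∈ vertices p) (adj⇒next x→y) (start∈vertices p)
    ... | no z≢x with ∈-vertices⇒arc p z∈ z≢x
    ...   | _ , a , a∈ = subst (_∈ vertices p) (adj⇒next a) (arc-head∈vertices p a∈)

    cycle-covers : ∀ {x y} → adj D x y ≡ true → (p : Walk D y x) → ∀ z → z ∈ vertices p
    cycle-covers {y = y} x→y p z =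
      reachable-closed (cycle-next-closed x→y p) (proj₁ (sc y z)) (start∈vertices p)

    arc-on-cycle : ∀ {x y} → adj D x y ≡ true → (p : Walk D y x) →
                   (e : Arc D) → tail e ≢ x → e ∈ arcs p
    arc-on-cycle x→y p e@((z , _) , _) z≢x with ∈-vertices⇒arc p (cycle-covers x→y p z) z≢x
    ... | _ , _ , a∈ = subst (_∈ arcs p) (tail-injective functional _ e refl) a∈

    rainbowConnecting-injective : ∀ {k} {c : Colouring D k} → RainbowConnecting c →
                                  (x : V D) (e₁ e₂ : Arc D) → tail e₁ ≢ x → tail e₂ ≢ x →
                                  c e₁ ≡ c e₂ → e₁ ≡ e₂
    rainbowConnecting-injective rc x e₁ e₂ t₁≢x t₂≢x c≡
      with rc (next x) x (adj⇒≢ (next-adj x) ∘ sym)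
    ... | p , _ , rainbow = unique-map-injective rainbow
            (arc-on-cycle (next-adj x) p e₁ t₁≢x) (arc-on-cycle (next-adj x) p e₂ t₂≢x) c≡

    fewerColours⇒¬rainbowConnecting : ∀ {m k} → 3 ≤ m → HasArcs D m → k < m →
                                       ¬ (∃[ c ] RainbowConnecting {D} {k} c)
    fewerColours⇒¬rainbowConnecting 3≤m arcs↔ k<m (c , rc)
      with i₁ , i₂ , i₁<i₂ , c≡ ← pigeonhole k<m (c ∘ Inverse.to arcs↔)
      with x , x≢t₁ , x≢t₂ ← avoid-two (subst (3 ≤_) (↔⇒≡ (tail↔ ↔-∘ arcs↔)) 3≤m)
                                       (tail (Inverse.to arcs↔ i₁)) (tail (Inverse.to arcs↔ i₂))
      = <⇒≢ i₁<i₂ (↔-to-injective arcs↔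
          (rainbowConnecting-injective rc x _ _ (x≢t₁ ∘ sym) (x≢t₂ ∘ sym) c≡))

    isDirectedCycle : ∀ {m} → HasArcs D m → IsDirectedCycle D m
    isDirectedCycle arcs↔ = subst (IsDirectedCycle D) (sym m≡k+1) (orbit , adjacency)
      where
      x₀ = tail e₀
      y₀ = next x₀
      p = proj₁ (sc y₀ x₀)
      k = len p

      period : ℕ.iterate next y₀ (suc k) ≡ y₀
      period = trans (iterate-suc next y₀ k) (cong next (walk-end p))

      orbit-unique : Unique (List.iterate next y₀ (suc k))
      orbit-unique = subst Unique (walk-vertices p) (proj₂ (sc y₀ x₀))

      orbit-complete : ∀ z → z ∈ List.iterate next y₀ (suc k)
      orbit-complete z = subst (z ∈_) (walk-vertices p) (cycle-covers (next-adj x₀) p z)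

      orbit : Fin (suc k) ↔ V D
      orbit = orbit↔ next y₀ orbit-unique orbit-complete

      m≡k+1 = trans (↔⇒≡ (tail↔ ↔-∘ arcs↔)) (sym (↔⇒≡ orbit))

      orbit-to : ∀ i → Inverse.to orbit i ≡ ℕ.iterate next y₀ (toℕ i)
      orbit-to = orbit↔-to next y₀ orbit-unique orbit-complete

      adjacency : ∀ i j → (adj D (Inverse.to orbit i) (Inverse.to orbit j) ≡ true)
                        ⇔ CycleArc (suc k) i j
      adjacency i j rewrite orbit-to i | orbit-to j =
        ⇔-sym (cycleArc⇔next next y₀ period injective i j) ⇔-∘ adj⇔next
        where
        injective : ∀ {i j} → ℕ.iterate next y₀ (toℕ i) ≡ ℕ.iterate next y₀ (toℕ j) → i ≡ j
        injective {i} {j} eq =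
          ↔-to-injective orbit (trans (orbit-to i) (trans eq (sym (orbit-to j))))

  twoArcsWithCommonTail⇒rainbowConnecting :
    ∀ {m} → StronglyConnected D → HasArcs D (suc m) →
    (e₁ e₂ : Arc D) → e₁ ≢ e₂ → tail e₁ ≡ tail e₂ → ∃[ c ] RainbowConnecting {D} {m} c
  twoArcsWithCommonTail⇒rainbowConnecting sc arcs↔ e₁ e₂ e₁≢e₂ t₁≡t₂ =
    colour , tailDetermined⇒rainbowConnecting sc colour tail-determined
    where
    open Inverse arcs↔ using (from)
    from-injective = ↔-from-injective arcs↔

    colour : Arc D → Fin _
    colour = identify (e₁≢e₂ ∘ from-injective) ∘ from

    tail≡t₁ : ∀ {a} → from a ≡ from e₁ ⊎ from a ≡ from e₂ → tail a ≡ tail e₁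
    tail≡t₁ (inj₁ eq) = cong tail (from-injective eq)
    tail≡t₁ (inj₂ eq) = trans (cong tail (from-injective eq)) (sym t₁≡t₂)

    tail-determined : ∀ {a b} → colour a ≡ colour b → tail a ≡ tail b
    tail-determined eq with identify-≡ (e₁≢e₂ ∘ from-injective) eq
    ... | inj₁ eq′          = cong tail (from-injective eq′)
    ... | inj₂ (a∈ , b∈) = trans (tail≡t₁ a∈) (sym (tail≡t₁ b∈))

  rc*⇒functional : ∀ {m} → StronglyConnected D → HasArcs D (suc m) → rc*≡ D (suc m) →
                   Functional D
  rc*⇒functional {m} sc arcs↔ (_ , minimal) {x} {y} {y′} a b with y ≟ y′
  ... | yes y≡y′ = y≡y′
  ... | no y≢y′  = ⊥-elim (minimal m (n<1+n m)
        (twoArcsWithCommonTail⇒rainbowConnecting sc arcs↔ ((x , y) , a) ((x , y′) , b)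
          (y≢y′ ∘ cong head) refl))

  directedCycle⇒functional : ∀ {m} → IsDirectedCycle D m → Functional D
  directedCycle⇒functional (f , adj⇔) {x} {y} {y′} a b =
    ↔-from-injective f (cycleArc-functional (cycleArc a) (cycleArc b))
    where
    open Inverse f
    cycleArc : ∀ {v} → adj D x v ≡ true → CycleArc _ (from x) (from v)
    cycleArc {v} a = Equivalence.to (adj⇔ (from x) (from v))
      (subst₂ (λ s t → adj D s t ≡ true) (sym (strictlyInverseˡ x)) (sym (strictlyInverseˡ v)) a)

  directedCycle⇒rc*≡src*≡ : ∀ {m} → 3 ≤ m → StronglyConnected D → HasArcs D m →
                            IsDirectedCycle D m → rc*≡ D m × src*≡ D m
  directedCycle⇒rc*≡src*≡ {suc m} 3≤m sc arcs↔ cycle =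
      ((Inverse.from arcs↔ , stronglyRainbowConnecting⇒rainbowConnecting strongly) , fewer)
    , ((Inverse.from arcs↔ , strongly) ,
       λ k k<m → fewer k k<m ∘ map₂ stronglyRainbowConnecting⇒rainbowConnecting)
    where
    functional : Functional D
    functional = directedCycle⇒functional cycle
    open FunctionalDigraph sc functional (Inverse.to arcs↔ zero)

    strongly : StronglyRainbowConnecting (Inverse.from arcs↔)
    strongly = injective⇒stronglyRainbowConnecting functional sc _ (↔-from-injective arcs↔)

    fewer : ∀ k → k < suc m → ¬ (∃[ c ] RainbowConnecting {D} {k} c)
    fewer _ = fewerColours⇒¬rainbowConnecting 3≤m arcs↔

corollary5 : (D : Digraph) → (m : ℕ) → 3 ≤ m → StronglyConnected D → HasArcs D m
    → (rc*≡ D m × src*≡ D m) ⇔ IsDirectedCycle D m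
corollary5 D (suc m) 3≤m sc arcs↔ = mk⇔ directedCycle (directedCycle⇒rc*≡src*≡ 3≤m sc arcs↔)
  where
  directedCycle : rc*≡ D (suc m) × src*≡ D (suc m) → IsDirectedCycle D (suc m)
  directedCycle (rc* , _) =
    FunctionalDigraph.isDirectedCycle sc (rc*⇒functional sc arcs↔ rc*) (Inverse.to arcs↔ zero) arcs↔
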